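{- Let $I=\widehat O\cup\bigcup_{k=1}^h\{a_k,b_k,c_k\}$ be an $(\alpha,\beta,3)$-ANI instance with capacity $W$ satisfying $w_{a_k}\ge W/2$ for all $k$, viewed as a cutting stock instance with item types $1,\dots,n$ of distinct weights $w_1>w_2>\dots>w_n$ and demands $d_i$ (the number of items of $I$ of weight $w_i$). Let $\mathrm{dp}^{n+1},\mathrm{dp}^n,\dots,\mathrm{dp}^1$ be the vectors produced by the dynamic programming procedure described in the context, and let $a$ be an item type whose weight equals $w_{a_k}$ for some $k\in\{1,\dots,h\}$. Then $\mathrm{dp}^1[w_{a_k}]=\mathrm{dp}^{a+1}[w_{a_k}]$.
   Context: ANI instance: a Bin Packing instance (items with positive integer weights, capacity $W$) whose items can be partitioned as $I=\widehat O\cup\bigcup_{k=1}^h\{a_k,b_k,c_k\}$ with $|\widehat O|=\alpha$, $\sum_{i\in\widehat O}w_i=\beta W$, $z_{\mathrm{LP}}^{\widehat O}=\beta$, $z_{\mathrm{ILP}}^{\widehat O}=\beta+1$ ($z_{\mathrm{ILP}}$ the minimum number of bins; $z_{\mathrm{LP}}$ the value of the linear relaxation of the set covering formulation over all multisets of items of total weight at most $W$), $w_{a_k}+w_{b_k}+w_{c_k}=W$ for each $k$, and for each $k$ no subset $S\subseteq\widehat O\cup\{a_g,b_g,c_g:g<k\}$ with $\sum_{i\in S}w_i+w_{a_k}=W$. Graph: for each type $i$, let $R_{<i}=\{\sum_{j<i}m_jw_j:0\le m_j\le d_j\}$ and $R_{>i}=\{\sum_{j>i}m_jw_j:0\le m_j\le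 d_j\}$, and let $\mathrm{Adj}[i]$ be the set of pairs $(p,m)$ with $1\le m\le d_i$, $p\in R_{<i}$, $p+mw_i\le W$ and $W-p-mw_i\in R_{>i}$, listed in some fixed order. DP: each $\mathrm{dp}[p]$, $p=0,\dots,W$, is either the symbol $\bot$ or a finite set of weights. Initially $\mathrm{dp}[p]=\bot$ for $p<W$ and $\mathrm{dp}[W]=\emptyset$; call this vector $\mathrm{dp}^{n+1}$. For $i=n,n-1,\dots,1$: if $d_i=0$ do nothing; otherwise, for each $(p,m)\in\mathrm{Adj}[i]$ in order, if $\mathrm{dp}[p+mw_i]\ne\bot$ then: if $\mathrm{dp}[p]=\bot$ or $p+w_i=W$, set $\mathrm{dp}[p]\gets\mathrm{dp}[p+mw_i]\cup\{w_i\}$; otherwise set $\mathrm{dp}[p]\gets\mathrm{dp}[p]\cap(\mathrm{dp}[p+mw_i]\cup\{w_i\})$. The updates are performed in place on a single vector; $\mathrm{dp}^i$ denotes the vector after processing type $i$. -}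

module Defs where

open import Data.Nat using (ℕ; zero; suc; _+_; _*_; _∸_; _≤_; _<_; _≟_; _≡ᵇ_)
open import Data.Bool using (Bool; true; false; _∨_; _∧_; if_then_else_)
open import Data.Maybe using (Maybe; just; nothing)
open import Data.List using (List; []; _∷_; _++_; length; filter; map; concat; foldl)
open import Data.List.Membership.Propositional using (_∈_)
open import Data.List.Relation.Unary.Unique.Propositional using (Unique)
open import Data.List.Relation.Binary.Sublist.Propositional using (_⊆_)
open import Data.List.Relation.Unary.All using (All)
open import Data.Fin using (Fin) renaming (zero to fzero; suc to fsuc; _≟_ to _≟ᶠ_)
open import Data.Product using (Σ; ∃; ∃-syntax; _×_; _,_; proj₁; proj₂)
open import Data.Integer using (+_)
open import Data.Rational as ℚ using (ℚ)
open import Relation.Binary.PropositionalEquality using (_≡_; _≢_)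
open import Relation.Nullary using (¬_; does)
open import Data.Nat.ListAction using (sum)
open import Function using (_⇔_)
open import Data.Unit using (⊤)
open import Data.Empty using (⊥)

-- Items are represented by their weights; a collection of items is a list
-- (i.e. a multiset) of positive natural numbers.

Triple : Set
Triple = ℕ × ℕ × ℕ

tripleList : Triple → List ℕ
tripleList (a , b , c) = a ∷ b ∷ c ∷ []

flatten : List Triple → List ℕ
flatten ts = concat (map tripleList ts)

instanceItems : List ℕ → List Triple → List ℕ
instanceItems os ts = os ++ flatten ts

load : (os : List ℕ) {b : ℕ} → (Fin (length os) → Fin b) → Fin b → ℕ
load [] f j = 0
load (x ∷ os) f j =
  (if does (f fzero ≟ᶠ j) then x else 0)
  + load os (λ i → f (fsuc i)) j

Packable : ℕ → List ℕ → ℕ → Set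
Packable W os b = Σ (Fin (length os) → Fin b) λ f → ∀ j → load os f j ≤ W

ILPValue : ℕ → List ℕ → ℕ → Set
ILPValue W os z = Packable W os z × (∀ b → b < z → ¬ Packable W os b)

-- Linear relaxation of the set covering formulation: a pattern is a
-- multiset of items (multiplicity of each item) of total weight ≤ W.

patternWeight : (os : List ℕ) → (Fin (length os) → ℕ) → ℕ
patternWeight [] m = 0
patternWeight (x ∷ os) m = m fzero * x + patternWeight os (λ i → m (fsuc i))

Pattern : ℕ → List ℕ → Set
Pattern W os = Σ (Fin (length os) → ℕ) λ m → patternWeight os m ≤ W

toℚ : ℕ → ℚ
toℚ n = + n ℚ./ 1

LPSol : ℕ → List ℕ → Set
LPSol W os = List (Pattern W os × ℚ)

lpValue : ∀ W os → LPSol W os → ℚ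
lpValue W os [] = ℚ.0ℚ
lpValue W os ((_ , x) ∷ s) = x ℚ.+ lpValue W os s

coverage : ∀ W os → LPSol W os → Fin (length os) → ℚ
coverage W os [] i = ℚ.0ℚ
coverage W os (((m , _) , x) ∷ s) i = x ℚ.* toℚ (m i) ℚ.+ coverage W os s i

Feasible : ∀ W os → LPSol W os → Set
Feasible W os s =
  All (λ px → ℚ.0ℚ ℚ.≤ proj₂ px) s × (∀ i → ℚ.1ℚ ℚ.≤ coverage W os s i)

-- z_LP(os) = z : z is attained by a feasible solution and is a lower bound
-- for every feasible solution (rational LPs attain their optimum at a
-- rational point).
LPValue : ℕ → List ℕ → ℕ → Set
LPValue W os z =
  (Σ (LPSol W os) λ s → Feasible W os s × lpValue W os s ≡ toℚ z)
  × (∀ (s : LPSol W os) → Feasible W os s → toℚ z ℚ.≤ lpValue W os s)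

-- (α, β, 3)-ANI instance with capacity W, Ô = os, triples ts = [(a_k,b_k,c_k)]

IsANI : ℕ → ℕ → ℕ → List ℕ → List Triple → Set
IsANI α β W os ts =
    All (λ x → 1 ≤ x) (instanceItems os ts)
  × length os ≡ α
  × sum os ≡ β * W
  × LPValue W os β
  × ILPValue W os (suc β)
  × All (λ t → sum (tripleList t) ≡ W) ts
  × (∀ (pre post : List Triple) (a b c : ℕ) →
       ts ≡ pre ++ ((a , b , c) ∷ post) →
       ∀ (S : List ℕ) → S ⊆ os ++ flatten pre → sum S + a ≢ W)

-- Cutting stock view: item types 1..n (w : ℕ → ℕ, only 1..n relevant)

count : ℕ → List ℕ → ℕ
count x I = length (filter (λ y → y ≟ x) I)

IsTypeList : List ℕ → ℕ → (ℕ → ℕ) → Set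
IsTypeList I n w =
    (∀ i j → 1 ≤ i → i < j → j ≤ n → w j < w i)
  × (∀ i → 1 ≤ i → i ≤ n → w i ∈ I)
  × (∀ x → x ∈ I → ∃[ i ] (1 ≤ i × i ≤ n × w i ≡ x))

SumRep : (ℕ → ℕ) → (ℕ → ℕ) → ℕ → ℕ → ℕ → Set
SumRep w d i zero p = p ≡ 0
SumRep w d i (suc k) p =
  ∃[ m ] ∃[ q ] (m ≤ d i × SumRep w d (suc i) k q × p ≡ m * w i + q)

RLess : (ℕ → ℕ) → (ℕ → ℕ) → ℕ → ℕ → Set
RLess w d i p = SumRep w d 1 (i ∸ 1) p

RGreater : ℕ → (ℕ → ℕ) → (ℕ → ℕ) → ℕ → ℕ → Set
RGreater n w d i p = SumRep w d (suc i) (n ∸ i) p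

InAdj : ℕ → ℕ → (ℕ → ℕ) → (ℕ → ℕ) → ℕ → ℕ × ℕ → Set
InAdj W n w d i (p , m) =
  1 ≤ m × m ≤ d i × RLess w d i p × p + m * w i ≤ W
  × RGreater n w d i (W ∸ (p + m * w i))

IsAdjOrder : ℕ → ℕ → (ℕ → ℕ) → (ℕ → ℕ) → (ℕ → List (ℕ × ℕ)) → Set
IsAdjOrder W n w d adj =
  ∀ i → 1 ≤ i → i ≤ n →
    Unique (adj i) × (∀ pm → (pm ∈ adj i) ⇔ InAdj W n w d i pm)

-- The DP. A finite set of weights is represented by its characteristic
-- function; ⊥ is nothing.

WSet : Set
WSet = ℕ → Bool

∅ : WSet
∅ _ = false

_∪⟨_⟩ : WSet → ℕ → WSet
(S ∪⟨ x ⟩) y = S y ∨ (y ≡ᵇ x)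

_∩_ : WSet → WSet → WSet
(S ∩ T) y = S y ∧ T y

DPVec : Set
DPVec = ℕ → Maybe WSet

dpInit : ℕ → DPVec
dpInit W p = if p ≡ᵇ W then just ∅ else nothing

setAt : ℕ → Maybe WSet → DPVec → DPVec
setAt p v dp q = if q ≡ᵇ p then v else dp q

dpStep : ℕ → ℕ → DPVec → ℕ × ℕ → DPVec
dpStep W wi dp (p , m) with dp (p + m * wi)
... | nothing = dp
... | just S with dp p
...   | nothing = setAt p (just (S ∪⟨ wi ⟩)) dp
...   | just T = if (p + wi) ≡ᵇ W
                 then setAt p (just (S ∪⟨ wi ⟩)) dp
                 else setAt p (just (T ∩ (S ∪⟨ wi ⟩))) dp

processType : ℕ → (ℕ → ℕ) → (ℕ → ℕ) → (ℕ → List (ℕ × ℕ)) → ℕ → DPVec → DPVec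
processType W w d adj i dp with d i
... | zero = dp
... | suc _ = foldl (dpStep W (w i)) dp (adj i)

-- vector after processing the k types n, n-1, ..., n-k+1
dpStage : ℕ → ℕ → (ℕ → ℕ) → (ℕ → ℕ) → (ℕ → List (ℕ × ℕ)) → ℕ → DPVec
dpStage W n w d adj zero = dpInit W
dpStage W n w d adj (suc k) = processType W w d adj (n ∸ k) (dpStage W n w d adj k)

dpVec : ℕ → ℕ → (ℕ → ℕ) → (ℕ → ℕ) → (ℕ → List (ℕ × ℕ)) → ℕ → DPVec
dpVec W n w d adj i = dpStage W n w d adj (suc n ∸ i)

EntryEq : Maybe WSet → Maybe WSet → Set
EntryEq nothing nothing = ⊤
EntryEq nothing (just _) = ⊥
EntryEq (just _) nothing = ⊥
EntryEq (just S) (just T) = ∀ x → S x ≡ T x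

module Submission where

open import Defs
open import Data.Nat using (ℕ; zero; suc; _+_; _∸_; _≤_; _<_; _*_; _≡ᵇ_; z≤n; s≤s)
open import Data.Nat.Properties
open import Data.Bool using (true; false; T)
open import Data.Maybe using (Maybe; just; nothing)
open import Data.List using (List; []; _∷_; foldl)
open import Data.List.Membership.Propositional using (_∈_)
open import Data.List.Relation.Unary.Any using (here; there)
open import Data.List.Relation.Unary.All as All using (All)
open import Data.Product using (∃-syntax; _×_; _,_; proj₁; proj₂)
open import Data.Sum using (_⊎_; inj₁; inj₂)
open import Data.Unit using (tt)
open import Function using (Equivalence; _$_)
open import Relation.Nullary using (contradiction)
open import Relation.Binary.PropositionalEquality

-- Processing type i writes only entries dp[p] with p ∈ R_{<i}.  For i ≤ a
-- such a p is 0 or at least the weight of a type heavier than a, so it is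
-- never w_a and dp[w_a] is frozen from dp^{a+1} on.

≡⇒EntryEq : ∀ {x y : Maybe WSet} → x ≡ y → EntryEq x y
≡⇒EntryEq {nothing} refl = tt
≡⇒EntryEq {just S} refl = λ _ → refl

Untouched : List (ℕ × ℕ) → ℕ → Set
Untouched pms q = ∀ pm → pm ∈ pms → proj₁ pm ≢ q

setAt-≢ : ∀ p v (dp : DPVec) q → p ≢ q → setAt p v dp q ≡ dp q
setAt-≢ p v dp q p≢q with q ≡ᵇ p in eq
... | true = contradiction (sym (≡ᵇ⇒≡ q p (subst T (sym eq) tt))) p≢q
... | false = refl

dpStep-≢ : ∀ W wi (dp : DPVec) p m q → p ≢ q → dpStep W wi dp (p , m) q ≡ dp q
dpStep-≢ W wi dp p m q p≢q with dp (p + m * wi)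
... | nothing = refl
... | just S with dp p
...   | nothing = setAt-≢ p _ dp q p≢q
...   | just _ with (p + wi) ≡ᵇ W
...     | true = setAt-≢ p _ dp q p≢q
...     | false = setAt-≢ p _ dp q p≢q

foldl-dpStep-untouched : ∀ W wi pms (dp : DPVec) q →
  Untouched pms q → foldl (dpStep W wi) dp pms q ≡ dp q
foldl-dpStep-untouched W wi [] dp q _ = refl
foldl-dpStep-untouched W wi ((p , m) ∷ pms) dp q u = begin
  foldl (dpStep W wi) (dpStep W wi dp (p , m)) pms q
    ≡⟨ foldl-dpStep-untouched W wi pms _ q (λ pm i → u pm (there i)) ⟩
  dpStep W wi dp (p , m) q
    ≡⟨ dpStep-≢ W wi dp p m q (u (p , m) (here refl)) ⟩
  dp q ∎
  where open ≡-Reasoning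

processType-untouched : ∀ W w d adj i (dp : DPVec) q →
  Untouched (adj i) q → processType W w d adj i dp q ≡ dp q
processType-untouched W w d adj i dp q u with d i
... | zero = refl
... | suc _ = foldl-dpStep-untouched W (w i) (adj i) dp q u

dpVec-suc : ∀ W n w d adj {i} → i ≤ n →
  dpVec W n w d adj i ≡ processType W w d adj i (dpVec W n w d adj (suc i))
dpVec-suc W n w d adj {i} i≤n rewrite +-∸-assoc 1 i≤n =
  cong (λ j → processType W w d adj j (dpStage W n w d adj (n ∸ i))) (m∸[m∸n]≡n i≤n)

dpVec-untouched : ∀ W n w d adj q {a} → a ≤ n →
  (∀ i → 1 ≤ i → i ≤ a → Untouched (adj i) q) →
  dpVec W n w d adj 1 q ≡ dpVec W n w d adj (suc a) q
dpVec-untouched W n w d adj q {zero} _ _ = refl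
dpVec-untouched W n w d adj q {suc a} a<n u = begin
  dpVec W n w d adj 1 q
    ≡⟨ dpVec-untouched W n w d adj q (<⇒≤ a<n) (λ i 1≤i i≤a → u i 1≤i (m≤n⇒m≤1+n i≤a)) ⟩
  dpVec W n w d adj (suc a) q
    ≡⟨ cong (_$ q) (dpVec-suc W n w d adj a<n) ⟩
  processType W w d adj (suc a) (dpVec W n w d adj (suc (suc a))) q
    ≡⟨ processType-untouched W w d adj (suc a) _ q (u (suc a) (s≤s z≤n) ≤-refl) ⟩
  dpVec W n w d adj (suc (suc a)) q ∎
  where open ≡-Reasoning

SumRep-≡0⊎> : ∀ {w d x} s k {p} → (∀ j → s ≤ j → j < s + k → x < w j) →
  SumRep w d s k p → p ≡ 0 ⊎ x < p
SumRep-≡0⊎> s zero _ p≡0 = inj₁ p≡0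
SumRep-≡0⊎> s (suc k) heavy (zero , _ , _ , rep , refl) =
  SumRep-≡0⊎> (suc s) k
    (λ j s<j j<s+k → heavy j (<⇒≤ s<j) (subst (j <_) (sym (+-suc s k)) j<s+k)) rep
SumRep-≡0⊎> {w} s (suc k) heavy (suc m , q , _ , _ , refl) = inj₂ (begin-strict
  _               <⟨ heavy s ≤-refl (subst (s <_) (sym (+-suc s k)) (s≤s (m≤m+n s k))) ⟩
  w s             ≤⟨ m≤m+n (w s) (m * w s) ⟩
  suc m * w s     ≤⟨ m≤m+n _ q ⟩
  suc m * w s + q ∎)
  where open ≤-Reasoning

RLess-≢ : ∀ {w d i x p} → 1 ≤ x → 1 ≤ i → (∀ j → 1 ≤ j → j < i → x < w j) →
  RLess w d i p → p ≢ x
RLess-≢ {i = i} 1≤x 1≤i heavy rep p≡x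
  with SumRep-≡0⊎> 1 (i ∸ 1) (λ j 1≤j j<i → heavy j 1≤j (subst (j <_) (m+[n∸m]≡n 1≤i) j<i)) rep
... | inj₁ p≡0 = <⇒≢ 1≤x (trans (sym p≡0) p≡x)
... | inj₂ x<p = <⇒≢ x<p (sym p≡x)

InAdj⇒RLess : ∀ {W n w d i p m} → InAdj W n w d i (p , m) → RLess w d i p
InAdj⇒RLess (_ , _ , p∈R<i , _) = p∈R<i

lemma6 : ∀ (α β W : ℕ) (os : List ℕ) (ts : List Triple) →
    IsANI α β W os ts →
    All (λ t → W ≤ 2 * proj₁ t) ts →
    ∀ (n : ℕ) (w : ℕ → ℕ) → IsTypeList (instanceItems os ts) n w →
    ∀ (adj : ℕ → List (ℕ × ℕ)) →
    IsAdjOrder W n w (λ i → count (w i) (instanceItems os ts)) adj →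
    ∀ (a : ℕ) → 1 ≤ a → a ≤ n →
    (∃[ t ] (t ∈ ts × w a ≡ proj₁ t)) →
    EntryEq
      (dpVec W n w (λ i → count (w i) (instanceItems os ts)) adj 1 (w a))
      (dpVec W n w (λ i → count (w i) (instanceItems os ts)) adj (suc a) (w a))
lemma6 α β W os ts (positive , _) _ n w (decreasing , typeInI , _) adj adjOrder a 1≤a a≤n _ =
  ≡⇒EntryEq (dpVec-untouched W n w d adj (w a) a≤n untouched)
  where
  d : ℕ → ℕ
  d i = count (w i) (instanceItems os ts)

  untouched : ∀ i → 1 ≤ i → i ≤ a → Untouched (adj i) (w a)
  untouched i 1≤i i≤a pm pm∈adj = RLess-≢
    (All.lookup positive (typeInI a 1≤a a≤n)) 1≤i
    (λ j 1≤j j<i → decreasing j a 1≤j (<-≤-trans j<i i≤a) a≤n)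
    (InAdj⇒RLess (Equivalence.to (proj₂ (adjOrder i 1≤i (≤-trans i≤a a≤n)) pm) pm∈adj))
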